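{- Let $a<b$ be positive integers and let $K_{a,b}$ be the complete bipartite graph with parts of sizes $a$ and $b$. Then $$1+\left\lceil \frac{b}{a}\right\rceil \leq \check s(K_{a,b}) \leq 1+\frac{b}{\gcd(a,b)}.$$
   Context: For a proper edge coloring $\varphi$ of a graph $G$, the palette of a vertex $v$ is the set of colors on edges incident with $v$. The palette index $\check s(G)$ is the minimum number of distinct palettes over all proper edge colorings of $G$. -}

module Defs where

open import Data.Nat using (ℕ; zero; suc; _+_; _∸_; _≤_; _<_; NonZero; ≢-nonZero; ≢-nonZero⁻¹)
open import Data.Nat.DivMod using (_/_)
open import Data.Nat.GCD using (gcd; gcd[m,n]≢0)

open import Data.Fin using (Fin)
open import Data.Sum using (_⊎_; inj₁; inj₂)
open import Data.Product using (Σ; ∃; _×_; _,_)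
open import Function using (Injective; Surjective)
open import Relation.Binary.PropositionalEquality using (_≡_)

-- Complete bipartite graph K_{a,b}: vertex set  Fin a ⊎ Fin b,
-- an edge {inj₁ i , inj₂ j} for every i : Fin a, j : Fin b, and no other edges.
Vertex : ℕ → ℕ → Set
Vertex a b = Fin a ⊎ Fin b

Colouring : ℕ → ℕ → Set
Colouring a b = Fin a → Fin b → ℕ

Proper : ∀ {a b} → Colouring a b → Set
Proper {a} {b} c =
  ((i : Fin a) → Injective _≡_ _≡_ (λ j → c i j)) ×
  ((j : Fin b) → Injective _≡_ _≡_ (λ i → c i j))

InPalette : ∀ {a b} → Colouring a b → Vertex a b → ℕ → Set
InPalette {a} {b} c (inj₁ i) x = ∃ λ (j : Fin b) → c i j ≡ x
InPalette {a} {b} c (inj₂ j) x = ∃ λ (i : Fin a) → c i j ≡ x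

SamePalette : ∀ {a b} → Colouring a b → Vertex a b → Vertex a b → Set
SamePalette c u v = ∀ x → (InPalette c u x → InPalette c v x) × (InPalette c v x → InPalette c u x)

-- The colouring c has exactly k distinct palettes: there is a surjective
-- labelling of the vertices by Fin k such that two vertices get the same
-- label iff they have the same palette (labels = distinct palettes).
NumPalettes : ∀ {a b} → Colouring a b → ℕ → Set
NumPalettes {a} {b} c k =
  Σ (Vertex a b → Fin k) λ f →
    Surjective _≡_ _≡_ f ×
    (∀ u v → (f u ≡ f v → SamePalette c u v) × (SamePalette c u v → f u ≡ f v))

PaletteIndex : ℕ → ℕ → ℕ → Set
PaletteIndex a b s =
  (∃ λ (c : Colouring a b) → Proper c × NumPalettes c s) ×
  (∀ (c : Colouring a b) k → Proper c → NumPalettes c k → s ≤ k)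

⌈_/_⌉ : (m n : ℕ) → .{{NonZero n}} → ℕ
⌈ m / n ⌉ = (m + (n ∸ 1)) / n

instance
  gcd-nonZero : ∀ {a b} → .{{NonZero a}} → NonZero (gcd a b)
  gcd-nonZero {a} {b} = ≢-nonZero (gcd[m,n]≢0 a b (inj₁ (≢-nonZero⁻¹ a)))

-- Sameness of palettes is a decidable
-- equivalence on the finite vertex set, so every colouring has a unique,
-- hence decidable, number of palettes (exact classifiers of a decidable
-- equivalence on a finite type, built by induction on Fin N).  Up to
-- renaming colours there are only finitely many colourings, so "k palettes
-- are achievable" is decidable and the least-number principle yields the
-- minimum s, the palette index.  No vertex of the small side shares its palette with one of
-- the large side, and a palette class of the large side has at most a
-- vertices; so the large side alone needs at least b / a palettes.  With g a common divisor of a and b, colour edge (x , y) by the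
-- base-g number with digits (x + y) mod g and (x / g + y / g) mod (b / g): all
-- small-side palettes coincide and a large-side palette depends only on y / g.
module Submission where

open import Defs
open import Data.Nat using (ℕ; _+_; _≤_; _<_; NonZero)
open import Data.Nat.DivMod using (_/_)
open import Data.Nat.GCD using (gcd)
open import Data.Product using (∃; _×_)

open import Data.Nat using (zero; suc; _*_; _∸_; s≤s; ≢-nonZero)
import Data.Nat.Properties as ℕ
open import Data.Nat.DivMod
open import Data.Nat.Divisibility using (_∣_; n∣m*n)
open import Data.Nat.GCD using (gcd[m,n]∣m; gcd[m,n]∣n)
open import Data.Nat.Tactic.RingSolver using (solve-∀)
open import Data.Fin using (Fin; zero; suc; toℕ; fromℕ<; combine; punchIn; punchOut; splitAt; join)
import Data.Fin.Properties as Fin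
open import Data.Vec using (Vec; []; _∷_; lookup; tabulate)
open import Data.Vec.Properties using (lookup∘tabulate)
open import Data.Empty using (⊥-elim)
open import Data.Sum using (_⊎_; inj₁; inj₂)
open import Data.Product using (Σ; _,_; proj₁; proj₂; swap)
open import Relation.Nullary using (Dec; yes; no; ¬_)
open import Relation.Nullary.Decidable using (map′; _×-dec_; _→-dec_)
open import Relation.Binary.Structures using (IsEquivalence; IsDecEquivalence)
open import Relation.Binary.PropositionalEquality
  using (_≡_; _≢_; refl; sym; trans; cong; cong₂; subst; subst₂; module ≡-Reasoning)
open import Function using (Injective; Surjective; _∘_; id; it)

module _ {P : ℕ → Set} (P? : ∀ k → Dec (P k)) where

  none-below-or-least : ∀ n → (∀ k → k < n → ¬ P k) ⊎ ∃ λ s → P s × (∀ k → P k → s ≤ k)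
  none-below-or-least zero = inj₁ λ _ ()
  none-below-or-least (suc n) with none-below-or-least n
  ... | inj₂ least = inj₂ least
  ... | inj₁ none with P? n
  ...   | yes pn = inj₂ (n , pn , λ k pk → ℕ.≮⇒≥ λ k<n → none k k<n pk)
  ...   | no ¬pn = inj₁ none-below-1+n
    where
    none-below-1+n : ∀ k → k < suc n → ¬ P k
    none-below-1+n k k<1+n with ℕ.m≤n⇒m<n∨m≡n (ℕ.≤-pred k<1+n)
    ... | inj₁ k<n  = none k k<n
    ... | inj₂ refl = ¬pn

  least-witness : ∀ n → P n → ∃ λ s → P s × (∀ k → P k → s ≤ k)
  least-witness n pn with none-below-or-least (suc n)
  ... | inj₁ none  = ⊥-elim (none n (ℕ.n<1+n n) pn)
  ... | inj₂ least = least

module Classification {V : Set} (_~_ : V → V → Set) where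

  Classifier : ℕ → Set
  Classifier k =
    Σ (V → Fin k) λ g →
      Surjective _≡_ _≡_ g × (∀ u v → (g u ≡ g v → u ~ v) × (u ~ v → g u ≡ g v))

  -- Counting classes: if g is onto and constant on classes and f separates
  -- classes, then f ∘ (a choice of g-preimages) is injective, so k ≤ K.
  labels-≤ : ∀ {k K} (g : V → Fin k) (f : V → Fin K) →
             Surjective _≡_ _≡_ g → (∀ u v → u ~ v → g u ≡ g v) →
             (∀ u v → f u ≡ f v → u ~ v) → k ≤ K
  labels-≤ {k} g f g-onto g-const f-separates = Fin.injective⇒≤ f∘rep-injective
    where
    rep : Fin k → V
    rep l = proj₁ (g-onto l)

    g∘rep : ∀ l → g (rep l) ≡ l
    g∘rep l = proj₂ (g-onto l) refl

    f∘rep-injective : Injective _≡_ _≡_ (f ∘ rep)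
    f∘rep-injective {l} {l′} e =
      trans (sym (g∘rep l)) (trans (g-const _ _ (f-separates _ _ e)) (g∘rep l′))

  classifier-unique : ∀ {k k′} → Classifier k → Classifier k′ → k ≡ k′
  classifier-unique (g , g-onto , g-exact) (h , h-onto , h-exact) = ℕ.≤-antisym
    (labels-≤ g h g-onto (λ u v → proj₂ (g-exact u v)) (λ u v → proj₁ (h-exact u v)))
    (labels-≤ h g h-onto (λ u v → proj₂ (h-exact u v)) (λ u v → proj₁ (g-exact u v)))

  classifier? : ∀ {k₀} → Classifier k₀ → ∀ k → Dec (Classifier k)
  classifier? {k₀} c₀ k = map′ (λ { refl → c₀ }) (λ c → classifier-unique c c₀) (k ℕ.≟ k₀)

open Classification using (Classifier)

-- Inductive step for classifying an equivalence on Fin (suc N), given a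
-- classifier g of its restriction to the successors: zero either joins the
-- class of some suc m, or forms a class of its own.
module Extend {N} {_~_ : Fin (suc N) → Fin (suc N) → Set} (equiv : IsEquivalence _~_)
              {k} (g : Fin N → Fin k) (g-onto : Surjective _≡_ _≡_ g)
              (g-exact : ∀ m n → (g m ≡ g n → suc m ~ suc n) × (suc m ~ suc n → g m ≡ g n))
  where
  open IsEquivalence equiv renaming (refl to ~-refl; sym to ~-sym; trans to ~-trans)

  joining : ∀ m → zero ~ suc m → Classifier _~_ k
  joining m 0~m = g ∘ shift , onto , exact
    where
    shift : Fin (suc N) → Fin N
    shift zero    = m
    shift (suc n) = n

    ~shift : ∀ v → v ~ suc (shift v)
    ~shift zero    = 0~m
    ~shift (suc n) = ~-refl

    onto : Surjective _≡_ _≡_ (g ∘ shift)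
    onto l = suc (proj₁ (g-onto l)) , λ { refl → proj₂ (g-onto l) refl }

    exact : ∀ u v → (g (shift u) ≡ g (shift v) → u ~ v) × (u ~ v → g (shift u) ≡ g (shift v))
    exact u v =
        (λ e → ~-trans (~shift u) (~-trans (proj₁ (g-exact _ _) e) (~-sym (~shift v))))
      , (λ u~v → proj₂ (g-exact _ _) (~-trans (~-sym (~shift u)) (~-trans u~v (~shift v))))

  fresh : (∀ m → ¬ zero ~ suc m) → Classifier _~_ (suc k)
  fresh alone = g′ , onto , exact
    where
    g′ : Fin (suc N) → Fin (suc k)
    g′ zero    = zero
    g′ (suc n) = suc (g n)

    onto : Surjective _≡_ _≡_ g′
    onto zero    = zero , λ { refl → refl }
    onto (suc l) = suc (proj₁ (g-onto l)) , λ { refl → cong suc (proj₂ (g-onto l) refl) }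

    exact : ∀ u v → (g′ u ≡ g′ v → u ~ v) × (u ~ v → g′ u ≡ g′ v)
    exact zero    zero    = (λ _ → ~-refl) , λ _ → refl
    exact zero    (suc n) = (λ ()) , λ 0~n → ⊥-elim (alone n 0~n)
    exact (suc m) zero    = (λ ()) , λ m~0 → ⊥-elim (alone m (~-sym m~0))
    exact (suc m) (suc n) = (λ e → proj₁ (g-exact m n) (Fin.suc-injective e))
                          , (λ m~n → cong suc (proj₂ (g-exact m n) m~n))

pullback : ∀ {V W : Set} {_~_ : V → V → Set} (e : W → V) →
           IsDecEquivalence _~_ → IsDecEquivalence (λ m n → e m ~ e n)
pullback e decEquiv = record
  { isEquivalence = record { refl = ~-refl ; sym = ~-sym ; trans = ~-trans }
  ; _≟_ = λ m n → e m ≟ e n }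
  where open IsDecEquivalence decEquiv renaming (refl to ~-refl; sym to ~-sym; trans to ~-trans)

classifier-exists : ∀ N {_~_ : Fin N → Fin N → Set} → IsDecEquivalence _~_ → ∃ (Classifier _~_)
classifier-exists zero    _ = 0 , (λ ()) , (λ ()) , λ ()
classifier-exists (suc N) decEquiv
  with classifier-exists N (pullback suc decEquiv)
     | Fin.any? (λ n → IsDecEquivalence._≟_ decEquiv zero (suc n))
... | k , g , g-onto , g-exact | yes (m , 0~m) =
  k , Extend.joining (IsDecEquivalence.isEquivalence decEquiv) g g-onto g-exact m 0~m
... | k , g , g-onto , g-exact | no alone =
  suc k , Extend.fresh (IsDecEquivalence.isEquivalence decEquiv) g g-onto g-exact
            (λ m 0~m → alone (m , 0~m))

classifier-exists-enumerated :
  ∀ {V : Set} {_~_ : V → V → Set} → IsDecEquivalence _~_ →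
  ∀ {N} (e : Fin N → V) (s : V → Fin N) → (∀ v → e (s v) ≡ v) → ∃ (Classifier _~_)
classifier-exists-enumerated {V} {_~_} decEquiv {N} e s section
  with classifier-exists N (pullback e decEquiv)
... | k , g , g-onto , g-exact = k , g ∘ s , onto , exact
  where
  open IsDecEquivalence decEquiv using (reflexive)
  onto : Surjective _≡_ _≡_ (g ∘ s)
  onto l = e n , λ { refl → trans (proj₂ (g-exact (s (e n)) n) (reflexive (section (e n))))
                                  (proj₂ (g-onto l) refl) }
    where n = proj₁ (g-onto l)
  exact : ∀ u v → (g (s u) ≡ g (s v) → u ~ v) × (u ~ v → g (s u) ≡ g (s v))
  exact u v =
      (λ e′ → subst₂ _~_ (section u) (section v) (proj₁ (g-exact (s u) (s v)) e′))
    , (λ u~v → proj₂ (g-exact (s u) (s v)) (subst₂ _~_ (sym (section u)) (sym (section v)) u~v))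

module _ {a b : ℕ} (c : Colouring a b) where

  inPalette? : ∀ v x → Dec (InPalette c v x)
  inPalette? (inj₁ i) x = Fin.any? λ j → c i j ℕ.≟ x
  inPalette? (inj₂ j) x = Fin.any? λ i → c i j ℕ.≟ x

  -- Inclusion of palettes is decided edge by edge: every colour at u is
  -- the colour of an edge incident with u.
  palette-⊆? : ∀ u v → Dec (∀ x → InPalette c u x → InPalette c v x)
  palette-⊆? (inj₁ i) v = map′ (λ h → λ { x (j , refl) → h j }) (λ h j → h _ (j , refl))
                                (Fin.all? λ j → inPalette? v (c i j))
  palette-⊆? (inj₂ j) v = map′ (λ h → λ { x (i , refl) → h i }) (λ h i → h _ (i , refl))
                                (Fin.all? λ i → inPalette? v (c i j))

  samePalette-isDecEquivalence : IsDecEquivalence (SamePalette c)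
  samePalette-isDecEquivalence = record
    { isEquivalence = record
      { refl  = λ x → id , id
      ; sym   = λ S x → swap (S x)
      ; trans = λ S T x → (λ p → proj₁ (T x) (proj₁ (S x) p)) , (λ p → proj₂ (S x) (proj₂ (T x) p)) }
    ; _≟_ = λ u v → map′ (λ (u⊆v , v⊆u) x → u⊆v x , v⊆u x)
                         (λ S → (λ x → proj₁ (S x)) , (λ x → proj₂ (S x)))
                         (palette-⊆? u v ×-dec palette-⊆? v u) }

  palettes-exist : ∃ (NumPalettes c)
  palettes-exist = classifier-exists-enumerated samePalette-isDecEquivalence
                     (splitAt a) (join a b) (Fin.splitAt-join a b)

  numPalettes? : ∀ k → Dec (NumPalettes c k)
  numPalettes? = Classification.classifier? (SamePalette c) (proj₂ palettes-exist)

-- Colour patterns: properness and palette counts depend only on which edges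
-- share a colour, so colourings may be normalised to a finite search space.
module _ {a b : ℕ} where

  Coarser : Colouring a b → Colouring a b → Set
  Coarser c c′ = ∀ i j i′ j′ → c i j ≡ c i′ j′ → c′ i j ≡ c′ i′ j′

  SamePattern : Colouring a b → Colouring a b → Set
  SamePattern c c′ = Coarser c c′ × Coarser c′ c

  proper-transfer : ∀ {c c′} → Coarser c c′ → Proper c′ → Proper c
  proper-transfer c⊑c′ (rows , columns) =
    (λ i {j} {j′} e → rows i (c⊑c′ i j i j′ e)) , (λ j {i} {i′} e → columns j (c⊑c′ i j i′ j e))

  edge-transfer : ∀ {c c′} → Coarser c c′ → ∀ v i j → InPalette c v (c i j) → InPalette c′ v (c′ i j)
  edge-transfer c⊑c′ (inj₁ i₂) i j (j₂ , e) = j₂ , c⊑c′ i₂ j₂ i j e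
  edge-transfer c⊑c′ (inj₂ j₂) i j (i₂ , e) = i₂ , c⊑c′ i₂ j₂ i j e

  palette-⊆-transfer : ∀ {c c′} → Coarser c c′ → ∀ u v →
    (∀ x → InPalette c u x → InPalette c v x) → ∀ x → InPalette c′ u x → InPalette c′ v x
  palette-⊆-transfer c⊑c′ (inj₁ i) v u⊆v x (j , refl) = edge-transfer c⊑c′ v i j (u⊆v _ (j , refl))
  palette-⊆-transfer c⊑c′ (inj₂ j) v u⊆v x (i , refl) = edge-transfer c⊑c′ v i j (u⊆v _ (i , refl))

  samePalette-transfer : ∀ {c c′} → Coarser c c′ → ∀ u v → SamePalette c u v → SamePalette c′ u v
  samePalette-transfer c⊑c′ u v S x =
      palette-⊆-transfer c⊑c′ u v (λ y → proj₁ (S y)) x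
    , palette-⊆-transfer c⊑c′ v u (λ y → proj₂ (S y)) x

  numPalettes-transfer : ∀ {c c′ k} → SamePattern c c′ → NumPalettes c k → NumPalettes c′ k
  numPalettes-transfer (c⊑c′ , c′⊑c) (f , onto , exact) =
    f , onto , λ u v → (λ e → samePalette-transfer c⊑c′ u v (proj₁ (exact u v) e))
                     , (λ S → proj₂ (exact u v) (samePalette-transfer c′⊑c u v S))

  rename : Colouring a b → ℕ → Fin (suc (a * b))
  rename c x with Fin.any? (λ i → Fin.any? (λ j → c i j ℕ.≟ x))
  ... | yes (i , j , _) = suc (combine i j)
  ... | no _            = zero

  rename-used : ∀ c i j → ∃ λ i₀ → ∃ λ j₀ →
                rename c (c i j) ≡ suc (combine i₀ j₀) × c i₀ j₀ ≡ c i j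
  rename-used c i j with Fin.any? (λ i′ → Fin.any? (λ j′ → c i′ j′ ℕ.≟ c i j))
  ... | yes (i₀ , j₀ , e) = i₀ , j₀ , refl , e
  ... | no unused         = ⊥-elim (unused (i , j , refl))

  rename-injective : ∀ c i j i′ j′ → rename c (c i j) ≡ rename c (c i′ j′) → c i j ≡ c i′ j′
  rename-injective c i j i′ j′ e
    with rename-used c i j | rename-used c i′ j′
  ... | i₀ , j₀ , r₀ , e₀ | i₁ , j₁ , r₁ , e₁
    with Fin.combine-injective i₀ j₀ i₁ j₁ (Fin.suc-injective (trans (sym r₀) (trans e r₁)))
  ... | refl , refl = trans (sym e₀) e₁

  Table : Set
  Table = Vec (Vec (Fin (suc (a * b))) b) a

  ⟦_⟧ : Table → Colouring a b
  ⟦ t ⟧ i j = toℕ (lookup (lookup t i) j)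

  normalise : Colouring a b → Table
  normalise c = tabulate λ i → tabulate λ j → rename c (c i j)

  normalise-pattern : ∀ c → SamePattern c ⟦ normalise c ⟧
  normalise-pattern c =
      (λ i j i′ j′ e → trans (entry i j) (trans (cong (λ x → toℕ (rename c x)) e) (sym (entry i′ j′))))
    , (λ i j i′ j′ e → rename-injective c i j i′ j′
                         (Fin.toℕ-injective (trans (sym (entry i j)) (trans e (entry i′ j′)))))
    where
    entry : ∀ i j → ⟦ normalise c ⟧ i j ≡ toℕ (rename c (c i j))
    entry i j = cong toℕ (trans (cong (λ row → lookup row j) (lookup∘tabulate _ i)) (lookup∘tabulate _ j))

Searchable : Set → Set₁
Searchable A = ∀ {P : A → Set} → (∀ x → Dec (P x)) → Dec (∃ P)

vec-searchable : ∀ {A} → Searchable A → ∀ n → Searchable (Vec A n)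
vec-searchable search zero    P? = map′ ([] ,_) (λ { ([] , p) → p }) (P? [])
vec-searchable search (suc n) P? =
  map′ (λ (x , xs , p) → x ∷ xs , p) (λ { (x ∷ xs , p) → x , xs , p })
       (search λ x → vec-searchable search n λ xs → P? (x ∷ xs))

injective? : ∀ {n} (f : Fin n → ℕ) → Dec (Injective _≡_ _≡_ f)
injective? f = map′ (λ h {x} {y} → h x y) (λ h x y → h)
                    (Fin.all? λ x → Fin.all? λ y → (f x ℕ.≟ f y) →-dec (x Fin.≟ y))

proper? : ∀ {a b} (c : Colouring a b) → Dec (Proper c)
proper? c = Fin.all? (λ i → injective? (c i)) ×-dec Fin.all? (λ j → injective? (λ i → c i j))

Achievable : ℕ → ℕ → ℕ → Set
Achievable a b k = ∃ λ (c : Colouring a b) → Proper c × NumPalettes c k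

-- Decidable, because it suffices to search the finitely many normalised tables.
achievable? : ∀ a b k → Dec (Achievable a b k)
achievable? a b k = map′ from-table to-table
  (vec-searchable (vec-searchable Fin.any? b) a λ t → proper? ⟦ t ⟧ ×-dec numPalettes? ⟦ t ⟧ k)
  where
  from-table : ∃ (λ (t : Table {a} {b}) → Proper ⟦ t ⟧ × NumPalettes ⟦ t ⟧ k) → Achievable a b k
  from-table (t , achieved) = ⟦ t ⟧ , achieved
  to-table : Achievable a b k → ∃ λ (t : Table {a} {b}) → Proper ⟦ t ⟧ × NumPalettes ⟦ t ⟧ k
  to-table (c , proper , palettes) =
    normalise c , proper-transfer (proj₂ same) proper , numPalettes-transfer same palettes
    where same = normalise-pattern c

module LowerBound {a b : ℕ} {c : Colouring a b} (proper : Proper c) where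

  -- A vertex of the small side never has the palette of one of the large side:
  -- its a colours would have to cover the b distinct colours at the latter.
  sides-differ : a < b → ∀ i j → ¬ SamePalette c (inj₁ i) (inj₂ j)
  sides-differ a<b i j S = ℕ.<⇒≱ a<b (Fin.injective⇒≤ row-injective)
    where
    -- the edge at j carrying the colour of edge (i , j′)
    row : Fin b → Fin a
    row j′ = proj₁ (proj₁ (S (c i j′)) (j′ , refl))

    row-colour : ∀ j′ → c (row j′) j ≡ c i j′
    row-colour j′ = proj₂ (proj₁ (S (c i j′)) (j′ , refl))

    row-injective : Injective _≡_ _≡_ row
    row-injective {j₁} {j₂} e =
      proj₁ proper i (trans (sym (row-colour j₁)) (trans (cong (λ i′ → c i′ j) e) (row-colour j₂)))

  -- Grouping the large side into m groups of equal palettes, with representatives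
  -- rep, gives b ≤ m · a: fixing i₀, vertex j is determined by its group and by
  -- the edge at its representative carrying the colour of (i₀ , j).
  groups-bound : (i₀ : Fin a) {m : ℕ} (group : Fin b → Fin m) (rep : Fin m → Fin b) →
                 (∀ j → SamePalette c (inj₂ j) (inj₂ (rep (group j)))) → b ≤ m * a
  groups-bound i₀ group rep same = Fin.injective⇒≤ code-injective
    where
    partner : Fin b → Fin a
    partner j = proj₁ (proj₁ (same j (c i₀ j)) (i₀ , refl))

    partner-colour : ∀ j → c (partner j) (rep (group j)) ≡ c i₀ j
    partner-colour j = proj₂ (proj₁ (same j (c i₀ j)) (i₀ , refl))

    code-injective : Injective _≡_ _≡_ (λ j → combine (group j) (partner j))
    code-injective {j₁} {j₂} e with Fin.combine-injective (group j₁) (partner j₁) (group j₂) (partner j₂) e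
    ... | same-group , same-partner = proj₁ proper i₀
      (trans (sym (partner-colour j₁))
        (trans (cong₂ (λ i′ g → c i′ (rep g)) same-partner same-group) (partner-colour j₂)))

  -- With k palette classes, the class ℓ₀ of a small-side vertex i₀ contains no
  -- large-side vertex, so the large side is grouped by the other k - 1 classes
  -- and groups-bound gives b ≤ (k - 1) a.
  palettes-lower-bound : a < b → Fin a → Fin b → ∀ {k} → NumPalettes c k →
                         ∃ λ k′ → k ≡ suc k′ × b ≤ k′ * a
  palettes-lower-bound a<b i₀ j₀ {zero} (f , _) = ⊥-elim (Fin.¬Fin0 (f (inj₁ i₀)))
  palettes-lower-bound a<b i₀ j₀ {suc k′} (f , onto , exact) =
    k′ , refl , groups-bound i₀ group (λ l → rep (punchIn ℓ₀ l)) grouped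
    where
    ℓ₀ = f (inj₁ i₀)

    not-ℓ₀ : ∀ j → ℓ₀ ≢ f (inj₂ j)
    not-ℓ₀ j e = sides-differ a<b i₀ j (proj₁ (exact (inj₁ i₀) (inj₂ j)) e)

    group : Fin b → Fin k′
    group j = punchOut (not-ℓ₀ j)

    -- a preimage of a class containing a large-side vertex is one
    large-side : Vertex a b → Fin b
    large-side (inj₁ _) = j₀
    large-side (inj₂ j) = j

    -- a large-side vertex with palette class l, if l is such a class (else j₀)
    rep : Fin (suc k′) → Fin b
    rep l = large-side (proj₁ (onto l))

    large-side-same : ∀ j v → SamePalette c (inj₂ j) v → SamePalette c (inj₂ j) (inj₂ (large-side v))
    large-side-same j (inj₁ i)  S = ⊥-elim (sides-differ a<b i j (λ x → swap (S x)))
    large-side-same j (inj₂ j′) S = S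

    rep-same : ∀ j → SamePalette c (inj₂ j) (inj₂ (rep (f (inj₂ j))))
    rep-same j = large-side-same j (proj₁ (onto l))
                   (proj₁ (exact (inj₂ j) (proj₁ (onto l))) (sym (proj₂ (onto l) refl)))
      where l = f (inj₂ j)

    grouped : ∀ j → SamePalette c (inj₂ j) (inj₂ (rep (punchIn ℓ₀ (group j))))
    grouped j = subst (λ l → SamePalette c (inj₂ j) (inj₂ (rep l)))
                      (sym (Fin.punchIn-punchOut (not-ℓ₀ j))) (rep-same j)

⌈/⌉-least : ∀ a₀ b k → b ≤ k * suc a₀ → ⌈ b / suc a₀ ⌉ ≤ k
⌈/⌉-least a₀ b k b≤ka = ℕ.≤-pred (m<n*o⇒m/o<n {n = suc k} b+a₀<[1+k]a)
  where
  b+a₀<[1+k]a : b + a₀ < suc k * suc a₀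
  b+a₀<[1+k]a = s≤s (subst (b + a₀ ≤_) (ℕ.+-comm (k * suc a₀) a₀) (ℕ.+-monoˡ-≤ a₀ b≤ka))

palettes-≥ : ∀ a₀ b → suc a₀ < b → ∀ {c : Colouring (suc a₀) b} {k} →
             Proper c → NumPalettes c k → 1 + ⌈ b / suc a₀ ⌉ ≤ k
palettes-≥ a₀ b a<b proper palettes
  with LowerBound.palettes-lower-bound proper a<b zero (fromℕ< a<b) palettes
... | k′ , refl , b≤k′a = s≤s (⌈/⌉-least a₀ b k′ b≤k′a)

module Modular (n : ℕ) .{{_ : NonZero n}} where
  open ≡-Reasoning

  %-absorbˡ : ∀ w t → (w % n + t) % n ≡ (w + t) % n
  %-absorbˡ w t = begin
    (w % n + t) % n              ≡⟨ [m+kn]%n≡m%n (w % n + t) (w / n) n ⟨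
    (w % n + t + w / n * n) % n  ≡⟨ cong (_% n) (exchange (w % n) t (w / n * n)) ⟩
    (w % n + w / n * n + t) % n  ≡⟨ cong (λ v → (v + t) % n) (m≡m%n+[m/n]*n w n) ⟨
    (w + t) % n                  ∎
    where
    exchange : ∀ p q r → p + q + r ≡ p + r + q
    exchange = solve-∀

  %-absorbʳ : ∀ s w → (s + w % n) % n ≡ (s + w) % n
  %-absorbʳ s w = begin
    (s + w % n) % n  ≡⟨ cong (_% n) (ℕ.+-comm s (w % n)) ⟩
    (w % n + s) % n  ≡⟨ %-absorbˡ w s ⟩
    (w + s) % n      ≡⟨ cong (_% n) (ℕ.+-comm w s) ⟩
    (s + w) % n      ∎

  -- Subtracting s modulo n, i.e. adding n ∸ s % n, undoes adding s.
  undo : ∀ s w → (s + w + (n ∸ s % n)) % n ≡ w % n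
  undo s w = begin
    (s + w + t) % n                ≡⟨ cong (λ v → (v + w + t) % n) (m≡m%n+[m/n]*n s n) ⟩
    (s % n + q + w + t) % n        ≡⟨ cong (_% n) (rearrange (s % n) q w t) ⟩
    (w + (s % n + t) + q) % n      ≡⟨ cong (λ v → (w + v + q) % n) (ℕ.m+[n∸m]≡n (m%n≤n s n)) ⟩
    (w + n + s / n * n) % n        ≡⟨ [m+kn]%n≡m%n (w + n) (s / n) n ⟩
    (w + n) % n                    ≡⟨ [m+n]%n≡m%n w n ⟩
    w % n                          ∎
    where
    t = n ∸ s % n
    q = s / n * n
    rearrange : ∀ r q w t → r + q + w + t ≡ w + (r + t) + q
    rearrange = solve-∀

  translate-injective : ∀ s {x y} → x < n → y < n → (s + x) % n ≡ (s + y) % n → x ≡ y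
  translate-injective s {x} {y} x<n y<n e = begin
    x                               ≡⟨ m<n⇒m%n≡m x<n ⟨
    x % n                           ≡⟨ undo s x ⟨
    (s + x + t) % n                 ≡⟨ %-absorbˡ (s + x) t ⟨
    ((s + x) % n + t) % n           ≡⟨ cong (λ v → (v + t) % n) e ⟩
    ((s + y) % n + t) % n           ≡⟨ %-absorbˡ (s + y) t ⟩
    (s + y + t) % n                 ≡⟨ undo s y ⟩
    y % n                           ≡⟨ m<n⇒m%n≡m y<n ⟩
    y                               ∎
    where t = n ∸ s % n

  translate-surjective : ∀ s {z} → z < n → ∃ λ x → x < n × (s + x) % n ≡ z
  translate-surjective s {z} z<n = (z + t) % n , m%n<n (z + t) n , (begin
    (s + (z + t) % n) % n  ≡⟨ %-absorbʳ s (z + t) ⟩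
    (s + (z + t)) % n      ≡⟨ cong (_% n) (ℕ.+-assoc s z t) ⟨
    (s + z + t) % n        ≡⟨ undo s z ⟩
    z % n                  ≡⟨ m<n⇒m%n≡m z<n ⟩
    z                      ∎)
    where t = n ∸ s % n

  digits : ∀ {Y} X → Y < n → (Y + X * n) % n ≡ Y × (Y + X * n) / n ≡ X
  digits {Y} X Y<n =
      trans ([m+kn]%n≡m%n Y X n) (m<n⇒m%n≡m Y<n)
    , (begin
      (Y + X * n) / n    ≡⟨ +-distrib-/-∣ʳ Y (n∣m*n X) ⟩
      Y / n + X * n / n  ≡⟨ cong₂ _+_ (m<n⇒m/n≡0 Y<n) (m*n/n≡m X n) ⟩
      X                  ∎)

  digits-< : ∀ {Y X N} → Y < n → X < N → Y + X * n < N * n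
  digits-< {Y} {X} Y<n X<N = ℕ.≤-trans (ℕ.+-monoˡ-≤ (X * n) Y<n) (ℕ.*-monoˡ-≤ n X<N)

  digits-injective : ∀ {x y} → x % n ≡ y % n → x / n ≡ y / n → x ≡ y
  digits-injective {x} {y} e₀ e₁ = begin
    x                  ≡⟨ m≡m%n+[m/n]*n x n ⟩
    x % n + x / n * n  ≡⟨ cong₂ (λ p q → p + q * n) e₀ e₁ ⟩
    y % n + y / n * n  ≡⟨ m≡m%n+[m/n]*n y n ⟨
    y                  ∎

-- All rows see all b′ g colours, and a column's palette depends
-- only on its block y / g, so there are at most 1 + b′ palettes.
module BlockColouring (g b′ : ℕ) .{{_ : NonZero g}} .{{_ : NonZero b′}} where
  private
    module G = Modular g
    module B = Modular b′
  open ≡-Reasoning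

  κ : ℕ → ℕ → ℕ
  κ x y = (x % g + y % g) % g + (x / g + y / g) % b′ * g

  κ-comm : ∀ x y → κ x y ≡ κ y x
  κ-comm x y = cong₂ (λ p q → p % g + q % b′ * g) (ℕ.+-comm (x % g) (y % g)) (ℕ.+-comm (x / g) (y / g))

  κ-< : ∀ x y → κ x y < b′ * g
  κ-< x y = G.digits-< (m%n<n _ g) (m%n<n _ b′)

  κ-digits : ∀ x y → κ x y % g ≡ (x % g + y % g) % g × κ x y / g ≡ (x / g + y / g) % b′
  κ-digits x y = G.digits _ (m%n<n _ g)

  κ-injective : ∀ x {y y′} → y < b′ * g → y′ < b′ * g → κ x y ≡ κ x y′ → y ≡ y′
  κ-injective x {y} {y′} y< y′< e = G.digits-injective low high
    where
    low : y % g ≡ y′ % g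
    low = G.translate-injective (x % g) (m%n<n y g) (m%n<n y′ g)
            (trans (sym (proj₁ (κ-digits x y))) (trans (cong (_% g) e) (proj₁ (κ-digits x y′))))
    high : y / g ≡ y′ / g
    high = B.translate-injective (x / g) (m<n*o⇒m/o<n y<) (m<n*o⇒m/o<n y′<)
            (trans (sym (proj₂ (κ-digits x y))) (trans (cong (_/ g) e) (proj₂ (κ-digits x y′))))

  κ-onto : ∀ x {z} → z < b′ * g → ∃ λ y → y < b′ * g × κ x y ≡ z
  κ-onto x {z} z<
    with G.translate-surjective (x % g) (m%n<n z g) | B.translate-surjective (x / g) (m<n*o⇒m/o<n z<)
  ... | y₀ , y₀< , e₀ | y₁ , y₁< , e₁ = y₀ + y₁ * g , G.digits-< y₀< y₁< , (begin
    κ x (y₀ + y₁ * g)                         ≡⟨ cong₂ (λ p q → (x % g + p) % g + (x / g + q) % b′ * g)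
                                                       (proj₁ (G.digits y₁ y₀<)) (proj₂ (G.digits y₁ y₀<)) ⟩
    (x % g + y₀) % g + (x / g + y₁) % b′ * g  ≡⟨ cong₂ (λ p q → p + q * g) e₀ e₁ ⟩
    z % g + z / g * g                         ≡⟨ m≡m%n+[m/n]*n z g ⟨
    z                                         ∎)

  -- Columns y, y′ in the same block see the same colours: the colour of (x , y)
  -- reappears at (x′ , y′) for x′ in the block of x (so x′ < N g when x is).
  κ-block : ∀ {N x y y′} → x < N * g → y / g ≡ y′ / g → ∃ λ x′ → x′ < N * g × κ x′ y′ ≡ κ x y
  κ-block {N} {x} {y} {y′} x< same with G.translate-surjective (y′ % g) (m%n<n (x % g + y % g) g)
  ... | x₀ , x₀< , e₀ = x₀ + x / g * g , G.digits-< x₀< (m<n*o⇒m/o<n {n = N} x<) , (begin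
    κ (x₀ + x / g * g) y′
      ≡⟨ cong₂ (λ p q → (p + y′ % g) % g + (q + y′ / g) % b′ * g) (proj₁ x′-digits) (proj₂ x′-digits) ⟩
    (x₀ + y′ % g) % g + (x / g + y′ / g) % b′ * g
      ≡⟨ cong₂ (λ p q → p + (x / g + q) % b′ * g) (trans (cong (_% g) (ℕ.+-comm x₀ (y′ % g))) e₀) (sym same) ⟩
    κ x y ∎)
    where x′-digits = G.digits (x / g) x₀<

  module _ (a′ : ℕ) (a<b : a′ * g < b′ * g) where

    colouring : Colouring (a′ * g) (b′ * g)
    colouring i j = κ (toℕ i) (toℕ j)

    -- Rows are injective by κ-injective, columns by symmetry of κ (as a′ g < b′ g).
    colouring-proper : Proper colouring
    colouring-proper =
        (λ i {j} {j′} e → Fin.toℕ-injective (κ-injective (toℕ i) (Fin.toℕ<n j) (Fin.toℕ<n j′) e))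
      , (λ j {i} {i′} e → Fin.toℕ-injective (κ-injective (toℕ j) (below-b i) (below-b i′)
                            (trans (κ-comm (toℕ j) (toℕ i)) (trans e (κ-comm (toℕ i′) (toℕ j))))))
      where
      below-b : (i : Fin (a′ * g)) → toℕ i < b′ * g
      below-b i = ℕ.<-trans (Fin.toℕ<n i) a<b

    rows-share : ∀ i₁ i₂ x → InPalette colouring (inj₁ i₁) x → InPalette colouring (inj₁ i₂) x
    rows-share i₁ i₂ x (j , refl) with κ-onto (toℕ i₂) (κ-< (toℕ i₁) (toℕ j))
    ... | y , y< , e = fromℕ< y< , trans (cong (κ (toℕ i₂)) (Fin.toℕ-fromℕ< y<)) e

    block-share : ∀ j₁ j₂ → toℕ j₁ / g ≡ toℕ j₂ / g → ∀ x →
                  InPalette colouring (inj₂ j₁) x → InPalette colouring (inj₂ j₂) x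
    block-share j₁ j₂ same x (i , refl) with κ-block {N = a′} (Fin.toℕ<n i) same
    ... | x′ , x′< , e = fromℕ< x′< , trans (cong (λ v → κ v (toℕ j₂)) (Fin.toℕ-fromℕ< x′<)) e

    label : Vertex (a′ * g) (b′ * g) → Fin (suc b′)
    label (inj₁ _) = zero
    label (inj₂ j) = suc (fromℕ< (m<n*o⇒m/o<n (Fin.toℕ<n j)))

    label-separates : ∀ u v → label u ≡ label v → SamePalette colouring u v
    label-separates (inj₁ i₁) (inj₁ i₂) _ x = rows-share i₁ i₂ x , rows-share i₂ i₁ x
    label-separates (inj₂ j₁) (inj₂ j₂) e x = block-share j₁ j₂ same x , block-share j₂ j₁ (sym same) x
      where
      same : toℕ j₁ / g ≡ toℕ j₂ / g
      same = trans (sym (Fin.toℕ-fromℕ< _)) (trans (cong toℕ (Fin.suc-injective e)) (Fin.toℕ-fromℕ< _))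

    block-colouring-palettes : ∃ λ k → k ≤ suc b′ × Achievable (a′ * g) (b′ * g) k
    block-colouring-palettes with palettes-exist colouring
    ... | k , palettes@(f , f-onto , f-exact) =
      k , Classification.labels-≤ (SamePalette colouring) f label f-onto
                                  (λ u v → proj₂ (f-exact u v)) label-separates
        , colouring , colouring-proper , palettes

common-divisor-construction : ∀ a b g .{{_ : NonZero g}} → g ∣ a → g ∣ b → a < b →
                              ∃ λ k → k ≤ 1 + b / g × Achievable a b k
common-divisor-construction a b g g∣a g∣b a<b =
  let k , k≤ , achieved = BlockColouring.block-colouring-palettes g (b / g) {{it}} {{b′-nonZero}}
                                                                    (a / g) a′g<b′g
  in  k , k≤ , subst₂ (λ a b → Achievable a b k) a′g≡a b′g≡b achieved
  where
  a′g≡a : a / g * g ≡ a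
  a′g≡a = m/n*n≡m g∣a
  b′g≡b : b / g * g ≡ b
  b′g≡b = m/n*n≡m g∣b
  b′-nonZero : NonZero (b / g)
  b′-nonZero = ≢-nonZero λ b′≡0 → ℕ.n≮0 (subst (a <_) (trans (sym b′g≡b) (cong (_* g) b′≡0)) a<b)
  a′g<b′g : a / g * g < b / g * g
  a′g<b′g = subst₂ _<_ (sym a′g≡a) (sym b′g≡b) a<b

theorem4p2 : (a b : ℕ) → .{{_ : NonZero a}} → a < b →
    ∃ λ s → PaletteIndex a b s × (1 + ⌈ b / a ⌉ ≤ s) × (s ≤ 1 + b / gcd a b)
theorem4p2 (suc a₀) b a<b =
  let k₀ , k₀≤ , achieved = common-divisor-construction (suc a₀) b (gcd (suc a₀) b)
                              {{gcd-nonZero {suc a₀} {b}}} (gcd[m,n]∣m (suc a₀) b) (gcd[m,n]∣n (suc a₀) b) a<b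
      s , (c , proper , palettes) , least = least-witness (achievable? (suc a₀) b) k₀ achieved
  in  s , ((c , proper , palettes) , λ c′ k proper′ palettes′ → least k (c′ , proper′ , palettes′))
        , palettes-≥ a₀ b a<b proper palettes
        , ℕ.≤-trans (least k₀ achieved) k₀≤
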